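{- An algebra $\mathbf{D}=(D;\sqcap,\sqcup,\neg,\lrcorner,\top,\bot)$ of type $(2,2,1,1,0,0)$ is a double Boolean algebra if and only if it is a D-core algebra.
   Context: For an algebra $(D;\sqcap,\sqcup,\neg,\lrcorner,\top,\bot)$ of type $(2,2,1,1,0,0)$ write $x\vee y:=\neg(\neg x\sqcap\neg y)$ and $x\wedge y:=\lrcorner(\lrcorner x\sqcup\lrcorner y)$. A double Boolean algebra (dBa) is such an algebra satisfying, for all $x,y,z\in D$: $(x\sqcap x)\sqcap y=x\sqcap y$; $(x\sqcup x)\sqcup y=x\sqcup y$; $x\sqcap y=y\sqcap x$; $x\sqcup y=y\sqcup x$; $\neg(x\sqcap x)=\neg x$; $\lrcorner(x\sqcup x)=\lrcorner x$; $x\sqcap(x\sqcup y)=x\sqcap x$; $x\sqcup(x\sqcap y)=x\sqcup x$; $x\sqcap(y\vee z)=(x\sqcap y)\vee(x\sqcap z)$; $x\sqcup(y\wedge z)=(x\sqcup y)\wedge(x\sqcup z)$; $x\sqcap(x\vee y)=x\sqcap x$; $x\sqcup(x\wedge y)=x\sqcup x$; $\neg\neg(x\sqcap y)=x\sqcap y$; $\lrcorner\lrcorner(x\sqcup y)=x\sqcup y$; $x\sqcap\neg x=\bot$; $x\sqcup\lrcorner x=\top$; $\neg\top=\bot$; $\lrcorner\bot=\top$; $x\sqcap(y\sqcap z)=(x\sqcap y)\sqcap z$; $x\sqcup(y\sqcup z)=(x\sqcup y)\sqcup z$; $\neg\bot=\top\sqcap\top$; $\lrcorner\top=\bot\sqcup\bot$;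 $(x\sqcap x)\sqcup(x\sqcap x)=(x\sqcup x)\sqcap(x\sqcup x)$. A D-core algebra is such an algebra satisfying, for all $x,y,z\in D$: (1a) $x\sqcap y=y\sqcap x$, (1b) $x\sqcup y=y\sqcup x$; (2a) $\neg(x\sqcap x)=\neg x$, (2b) $\lrcorner(x\sqcup x)=\lrcorner x$; (3a) $x\sqcap(x\sqcup y)=x\sqcap x$, (3b) $x\sqcup(x\sqcap y)=x\sqcup x$; (4a) $x\sqcap(y\vee z)=(x\sqcap y)\vee(x\sqcap z)$, (4b) $x\sqcup(y\wedge z)=(x\sqcup y)\wedge(x\sqcup z)$; (5a) $\neg\neg(x\sqcap y)=x\sqcap y$, (5b) $\lrcorner\lrcorner(x\sqcup y)=x\sqcup y$; (6a) $x\sqcap\neg x=\bot$, (6b) $x\sqcup\lrcorner x=\top$; (7) $(x\sqcap x)\sqcup(x\sqcap x)=(x\sqcup x)\sqcap(x\sqcup x)$. -}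

module Defs where

open import Level using (Level) renaming (suc to lsuc)
open import Relation.Binary.PropositionalEquality using (_≡_)

record Algebra2211 (ℓ : Level) : Set (lsuc ℓ) where
  infixr 7 _⊓_
  infixr 6 _⊔_
  field
    D   : Set ℓ
    _⊓_ : D → D → D
    _⊔_ : D → D → D
    ¬_  : D → D
    ⌟_  : D → D
    ⊤   : D
    ⊥   : D

  _∨_ : D → D → D
  x ∨ y = ¬ ((¬ x) ⊓ (¬ y))

  _∧_ : D → D → D
  x ∧ y = ⌟ ((⌟ x) ⊔ (⌟ y))

record IsDBA {ℓ : Level} (A : Algebra2211 ℓ) : Set ℓ where
  open Algebra2211 A
  field
    ⊓-idem-left : ∀ x y → (x ⊓ x) ⊓ y ≡ x ⊓ y
    ⊔-idem-left : ∀ x y → (x ⊔ x) ⊔ y ≡ x ⊔ y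
    ⊓-comm      : ∀ x y → x ⊓ y ≡ y ⊓ x
    ⊔-comm      : ∀ x y → x ⊔ y ≡ y ⊔ x
    ¬-⊓-idem    : ∀ x → ¬ (x ⊓ x) ≡ ¬ x
    ⌟-⊔-idem    : ∀ x → ⌟ (x ⊔ x) ≡ ⌟ x
    ⊓-abs-⊔     : ∀ x y → x ⊓ (x ⊔ y) ≡ x ⊓ x
    ⊔-abs-⊓     : ∀ x y → x ⊔ (x ⊓ y) ≡ x ⊔ x
    ⊓-distrib-∨ : ∀ x y z → x ⊓ (y ∨ z) ≡ (x ⊓ y) ∨ (x ⊓ z)
    ⊔-distrib-∧ : ∀ x y z → x ⊔ (y ∧ z) ≡ (x ⊔ y) ∧ (x ⊔ z)
    ⊓-abs-∨     : ∀ x y → x ⊓ (x ∨ y) ≡ x ⊓ x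
    ⊔-abs-∧     : ∀ x y → x ⊔ (x ∧ y) ≡ x ⊔ x
    ¬¬-⊓        : ∀ x y → ¬ (¬ (x ⊓ y)) ≡ x ⊓ y
    ⌟⌟-⊔        : ∀ x y → ⌟ (⌟ (x ⊔ y)) ≡ x ⊔ y
    ⊓-¬         : ∀ x → x ⊓ (¬ x) ≡ ⊥
    ⊔-⌟         : ∀ x → x ⊔ (⌟ x) ≡ ⊤
    ¬⊤          : ¬ ⊤ ≡ ⊥
    ⌟⊥          : ⌟ ⊥ ≡ ⊤
    ⊓-assoc     : ∀ x y z → x ⊓ (y ⊓ z) ≡ (x ⊓ y) ⊓ z
    ⊔-assoc     : ∀ x y z → x ⊔ (y ⊔ z) ≡ (x ⊔ y) ⊔ z
    ¬⊥          : ¬ ⊥ ≡ ⊤ ⊓ ⊤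
    ⌟⊤          : ⌟ ⊤ ≡ ⊥ ⊔ ⊥
    mixed       : ∀ x → (x ⊓ x) ⊔ (x ⊓ x) ≡ (x ⊔ x) ⊓ (x ⊔ x)

record IsDCore {ℓ : Level} (A : Algebra2211 ℓ) : Set ℓ where
  open Algebra2211 A
  field
    ax1a : ∀ x y → x ⊓ y ≡ y ⊓ x
    ax1b : ∀ x y → x ⊔ y ≡ y ⊔ x
    ax2a : ∀ x → ¬ (x ⊓ x) ≡ ¬ x
    ax2b : ∀ x → ⌟ (x ⊔ x) ≡ ⌟ x
    ax3a : ∀ x y → x ⊓ (x ⊔ y) ≡ x ⊓ x
    ax3b : ∀ x y → x ⊔ (x ⊓ y) ≡ x ⊔ x
    ax4a : ∀ x y z → x ⊓ (y ∨ z) ≡ (x ⊓ y) ∨ (x ⊓ z)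
    ax4b : ∀ x y z → x ⊔ (y ∧ z) ≡ (x ⊔ y) ∧ (x ⊔ z)
    ax5a : ∀ x y → ¬ (¬ (x ⊓ y)) ≡ x ⊓ y
    ax5b : ∀ x y → ⌟ (⌟ (x ⊔ y)) ≡ x ⊔ y
    ax6a : ∀ x → x ⊓ (¬ x) ≡ ⊥
    ax6b : ∀ x → x ⊔ (⌟ x) ≡ ⊤
    ax7 : ∀ x → (x ⊓ x) ⊔ (x ⊓ x) ≡ (x ⊔ x) ⊓ (x ⊔ x)

{-# OPTIONS --safe #-}
-- The ⊓-half of the dBa axioms follows from the ⊓-half of the D-core axioms
-- together with x ⊓ ⊤ = x ⊓ x, which a D-core algebra gets from (3a) and (6b);
-- the ⊔-half is dual. Within a half, the elements ¬¬x (which include all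
-- x ⊓ y) behave like a Boolean algebra under ⊓, ∨, ¬: ∨ distributes over ⊓ and
-- ⊥ is absorbing, so, as in Huntington's proof, two such elements that agree
-- after joining with a and with ¬a are equal. Associativity of ⊓ follows.
module Submission where

open import Defs
open import Level using (Level)
open import Function.Bundles using (_⇔_; mk⇔)
open import Relation.Binary.PropositionalEquality

module Half {ℓ : Level} {D : Set ℓ} (_⊓_ : D → D → D) (¬_ : D → D) (⊤ ⊥ : D) where

  _∨_ : D → D → D
  x ∨ y = ¬ ((¬ x) ⊓ (¬ y))

  record IsHalf : Set ℓ where
    field
      ⊓-comm      : ∀ x y → x ⊓ y ≡ y ⊓ x
      ¬-⊓-idem    : ∀ x → ¬ (x ⊓ x) ≡ ¬ x
      ⊓-distrib-∨ : ∀ x y z → x ⊓ (y ∨ z) ≡ (x ⊓ y) ∨ (x ⊓ z)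
      ¬¬-⊓        : ∀ x y → ¬ (¬ (x ⊓ y)) ≡ x ⊓ y
      ⊓-¬         : ∀ x → x ⊓ (¬ x) ≡ ⊥
      ⊓-⊤         : ∀ x → x ⊓ ⊤ ≡ x ⊓ x

  module Properties (half : IsHalf) where
    open IsHalf half
    open ≡-Reasoning

    ¬¬¬x≡¬x : ∀ x → ¬ (¬ (¬ x)) ≡ ¬ x
    ¬¬¬x≡¬x x = begin
      ¬ (¬ (¬ x))        ≡⟨ cong (λ u → ¬ (¬ u)) (¬-⊓-idem x) ⟨
      ¬ (¬ (¬ (x ⊓ x)))  ≡⟨ cong ¬_ (¬¬-⊓ x x) ⟩
      ¬ (x ⊓ x)          ≡⟨ ¬-⊓-idem x ⟩
      ¬ x                ∎

    x⊓x≡¬¬x : ∀ x → x ⊓ x ≡ ¬ (¬ x)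
    x⊓x≡¬¬x x = trans (sym (¬¬-⊓ x x)) (cong ¬_ (¬-⊓-idem x))

    ⊓-¬¬ʳ : ∀ x y → x ⊓ (¬ (¬ y)) ≡ x ⊓ y
    ⊓-¬¬ʳ x y = begin
      x ⊓ (¬ (¬ y))                        ≡⟨ cong (x ⊓_) (¬-⊓-idem (¬ y)) ⟨
      x ⊓ (y ∨ y)                          ≡⟨ ⊓-distrib-∨ x y y ⟩
      ¬ ((¬ (x ⊓ y)) ⊓ (¬ (x ⊓ y)))        ≡⟨ ¬-⊓-idem _ ⟩
      ¬ (¬ (x ⊓ y))                        ≡⟨ ¬¬-⊓ x y ⟩
      x ⊓ y                                ∎

    ⊓-¬¬ˡ : ∀ x y → (¬ (¬ x)) ⊓ y ≡ x ⊓ y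
    ⊓-¬¬ˡ x y = trans (⊓-comm _ y) (trans (⊓-¬¬ʳ y x) (⊓-comm y x))

    ⊓-idem-left : ∀ x y → (x ⊓ x) ⊓ y ≡ x ⊓ y
    ⊓-idem-left x y = trans (cong (_⊓ y) (x⊓x≡¬¬x x)) (⊓-¬¬ˡ x y)

    ¬¬⊤≡¬⊥ : ¬ (¬ ⊤) ≡ ¬ ⊥
    ¬¬⊤≡¬⊥ = begin
      ¬ (¬ ⊤)              ≡⟨ ¬-⊓-idem (¬ ⊤) ⟨
      ¬ ((¬ ⊤) ⊓ (¬ ⊤))    ≡⟨ cong ¬_ (⊓-⊤ (¬ ⊤)) ⟨
      ¬ ((¬ ⊤) ⊓ ⊤)        ≡⟨ cong ¬_ (⊓-comm (¬ ⊤) ⊤) ⟩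
      ¬ (⊤ ⊓ (¬ ⊤))        ≡⟨ cong ¬_ (⊓-¬ ⊤) ⟩
      ¬ ⊥                  ∎

    ¬¬⊥≡⊥ : ¬ (¬ ⊥) ≡ ⊥
    ¬¬⊥≡⊥ = begin
      ¬ (¬ ⊥)              ≡⟨ cong (λ u → ¬ (¬ u)) (⊓-¬ ⊤) ⟨
      ¬ (¬ (⊤ ⊓ (¬ ⊤)))    ≡⟨ ¬¬-⊓ ⊤ (¬ ⊤) ⟩
      ⊤ ⊓ (¬ ⊤)            ≡⟨ ⊓-¬ ⊤ ⟩
      ⊥                    ∎

    ¬⊤≡⊥ : ¬ ⊤ ≡ ⊥
    ¬⊤≡⊥ = begin
      ¬ ⊤            ≡⟨ ¬¬¬x≡¬x ⊤ ⟨
      ¬ (¬ (¬ ⊤))    ≡⟨ cong ¬_ ¬¬⊤≡¬⊥ ⟩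
      ¬ (¬ ⊥)        ≡⟨ ¬¬⊥≡⊥ ⟩
      ⊥              ∎

    ¬⊥≡⊤⊓⊤ : ¬ ⊥ ≡ ⊤ ⊓ ⊤
    ¬⊥≡⊤⊓⊤ = trans (sym ¬¬⊤≡¬⊥) (sym (x⊓x≡¬¬x ⊤))

    ¬⊥⊓x≡¬¬x : ∀ x → (¬ ⊥) ⊓ x ≡ ¬ (¬ x)
    ¬⊥⊓x≡¬¬x x = begin
      (¬ ⊥) ⊓ x      ≡⟨ cong (_⊓ x) ¬⊥≡⊤⊓⊤ ⟩
      (⊤ ⊓ ⊤) ⊓ x    ≡⟨ ⊓-idem-left ⊤ x ⟩
      ⊤ ⊓ x          ≡⟨ ⊓-comm ⊤ x ⟩
      x ⊓ ⊤          ≡⟨ ⊓-⊤ x ⟩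
      x ⊓ x          ≡⟨ x⊓x≡¬¬x x ⟩
      ¬ (¬ x)        ∎

    ∨-comm : ∀ x y → x ∨ y ≡ y ∨ x
    ∨-comm x y = cong ¬_ (⊓-comm (¬ x) (¬ y))

    ¬¬-∨ : ∀ x y → ¬ (¬ (x ∨ y)) ≡ x ∨ y
    ¬¬-∨ x y = ¬¬¬x≡¬x _

    ∨-⊥ : ∀ x → x ∨ ⊥ ≡ ¬ (¬ x)
    ∨-⊥ x = begin
      ¬ ((¬ x) ⊓ (¬ ⊥))        ≡⟨ cong (λ u → ¬ ((¬ x) ⊓ u)) ¬⊥≡⊤⊓⊤ ⟩
      ¬ ((¬ x) ⊓ (⊤ ⊓ ⊤))      ≡⟨ cong (λ u → ¬ ((¬ x) ⊓ u)) (x⊓x≡¬¬x ⊤) ⟩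
      ¬ ((¬ x) ⊓ (¬ (¬ ⊤)))    ≡⟨ cong ¬_ (⊓-¬¬ʳ (¬ x) ⊤) ⟩
      ¬ ((¬ x) ⊓ ⊤)            ≡⟨ cong ¬_ (⊓-⊤ (¬ x)) ⟩
      ¬ ((¬ x) ⊓ (¬ x))        ≡⟨ ¬-⊓-idem (¬ x) ⟩
      ¬ (¬ x)                  ∎

    ∨-¬ : ∀ x → x ∨ (¬ x) ≡ ¬ ⊥
    ∨-¬ x = begin
      ¬ ((¬ x) ⊓ (¬ (¬ x)))    ≡⟨ cong ¬_ (⊓-¬¬ʳ (¬ x) x) ⟩
      ¬ ((¬ x) ⊓ x)            ≡⟨ cong ¬_ (⊓-comm (¬ x) x) ⟩
      ¬ (x ⊓ (¬ x))            ≡⟨ cong ¬_ (⊓-¬ x) ⟩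
      ¬ ⊥                      ∎

    ∨-distrib-⊓ : ∀ x y z → x ∨ (y ⊓ z) ≡ (x ∨ y) ⊓ (x ∨ z)
    ∨-distrib-⊓ x y z = begin
      ¬ ((¬ x) ⊓ (¬ (y ⊓ z)))                   ≡⟨ cong (λ u → ¬ ((¬ x) ⊓ (¬ u))) ¬¬y⊓¬¬z≡y⊓z ⟨
      ¬ ((¬ x) ⊓ ((¬ y) ∨ (¬ z)))               ≡⟨ cong ¬_ (⊓-distrib-∨ (¬ x) (¬ y) (¬ z)) ⟩
      ¬ (¬ ((x ∨ y) ⊓ (x ∨ z)))                 ≡⟨ ¬¬-⊓ (x ∨ y) (x ∨ z) ⟩
      (x ∨ y) ⊓ (x ∨ z)                         ∎
      where
      ¬¬y⊓¬¬z≡y⊓z : (¬ (¬ y)) ⊓ (¬ (¬ z)) ≡ y ⊓ z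
      ¬¬y⊓¬¬z≡y⊓z = trans (⊓-¬¬ˡ y _) (⊓-¬¬ʳ y z)

    ⊓-zeroʳ : ∀ x → x ⊓ ⊥ ≡ ⊥
    ⊓-zeroʳ x = begin
      x ⊓ ⊥                    ≡⟨ trans (∨-⊥ (x ⊓ ⊥)) (¬¬-⊓ x ⊥) ⟨
      (x ⊓ ⊥) ∨ ⊥              ≡⟨ cong ((x ⊓ ⊥) ∨_) (⊓-¬ x) ⟨
      (x ⊓ ⊥) ∨ (x ⊓ (¬ x))    ≡⟨ ⊓-distrib-∨ x ⊥ (¬ x) ⟨
      x ⊓ (⊥ ∨ (¬ x))          ≡⟨ cong (x ⊓_) (trans (∨-comm ⊥ (¬ x)) (∨-⊥ (¬ x))) ⟩
      x ⊓ (¬ (¬ (¬ x)))        ≡⟨ cong (x ⊓_) (¬¬¬x≡¬x x) ⟩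
      x ⊓ (¬ x)                ≡⟨ ⊓-¬ x ⟩
      ⊥                        ∎

    ⊓-abs-∨ : ∀ x y → x ⊓ (x ∨ y) ≡ x ⊓ x
    ⊓-abs-∨ x y = begin
      x ⊓ (x ∨ y)              ≡⟨ ⊓-¬¬ˡ x _ ⟨
      (¬ (¬ x)) ⊓ (x ∨ y)      ≡⟨ cong (_⊓ (x ∨ y)) (∨-⊥ x) ⟨
      (x ∨ ⊥) ⊓ (x ∨ y)        ≡⟨ ∨-distrib-⊓ x ⊥ y ⟨
      x ∨ (⊥ ⊓ y)              ≡⟨ cong (x ∨_) (trans (⊓-comm ⊥ y) (⊓-zeroʳ y)) ⟩
      x ∨ ⊥                    ≡⟨ ∨-⊥ x ⟩
      ¬ (¬ x)                  ≡⟨ x⊓x≡¬¬x x ⟨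
      x ⊓ x                    ∎

    ∨-abs-⊓ : ∀ x y → x ∨ (x ⊓ y) ≡ ¬ (¬ x)
    ∨-abs-⊓ x y = begin
      x ∨ (x ⊓ y)              ≡⟨ ∨-distrib-⊓ x x y ⟩
      (x ∨ x) ⊓ (x ∨ y)        ≡⟨ cong (_⊓ (x ∨ y)) (¬-⊓-idem (¬ x)) ⟩
      (¬ (¬ x)) ⊓ (x ∨ y)      ≡⟨ ⊓-¬¬ˡ x _ ⟩
      x ⊓ (x ∨ y)              ≡⟨ ⊓-abs-∨ x y ⟩
      x ⊓ x                    ≡⟨ x⊓x≡¬¬x x ⟩
      ¬ (¬ x)                  ∎

    ¬x∨[x⊓y]≡¬x∨y : ∀ x y → (¬ x) ∨ (x ⊓ y) ≡ (¬ x) ∨ y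
    ¬x∨[x⊓y]≡¬x∨y x y = begin
      (¬ x) ∨ (x ⊓ y)                 ≡⟨ ∨-distrib-⊓ (¬ x) x y ⟩
      ((¬ x) ∨ x) ⊓ ((¬ x) ∨ y)       ≡⟨ cong (_⊓ ((¬ x) ∨ y)) (trans (∨-comm (¬ x) x) (∨-¬ x)) ⟩
      (¬ ⊥) ⊓ ((¬ x) ∨ y)             ≡⟨ ¬⊥⊓x≡¬¬x _ ⟩
      ¬ (¬ ((¬ x) ∨ y))               ≡⟨ ¬¬-∨ (¬ x) y ⟩
      (¬ x) ∨ y                       ∎

    ∨-cancel-by-complement : ∀ a {x y} → ¬ (¬ x) ≡ x → ¬ (¬ y) ≡ y →
                             a ∨ x ≡ a ∨ y → (¬ a) ∨ x ≡ (¬ a) ∨ y → x ≡ y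
    ∨-cancel-by-complement a {x} {y} ¬¬x≡x ¬¬y≡y a∨x≡a∨y ¬a∨x≡¬a∨y = begin
      x                                ≡⟨ ¬¬-split x ¬¬x≡x ⟩
      (a ∨ x) ⊓ ((¬ a) ∨ x)            ≡⟨ cong₂ _⊓_ a∨x≡a∨y ¬a∨x≡¬a∨y ⟩
      (a ∨ y) ⊓ ((¬ a) ∨ y)            ≡⟨ ¬¬-split y ¬¬y≡y ⟨
      y                                ∎
      where
      ¬¬-split : ∀ z → ¬ (¬ z) ≡ z → z ≡ (a ∨ z) ⊓ ((¬ a) ∨ z)
      ¬¬-split z ¬¬z≡z = begin
        z                              ≡⟨ trans (∨-⊥ z) ¬¬z≡z ⟨
        z ∨ ⊥                          ≡⟨ cong (z ∨_) (⊓-¬ a) ⟨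
        z ∨ (a ⊓ (¬ a))                ≡⟨ ∨-distrib-⊓ z a (¬ a) ⟩
        (z ∨ a) ⊓ (z ∨ (¬ a))          ≡⟨ cong₂ _⊓_ (∨-comm z a) (∨-comm z (¬ a)) ⟩
        (a ∨ z) ⊓ ((¬ a) ∨ z)          ∎

    ⊓-assoc : ∀ x y z → x ⊓ (y ⊓ z) ≡ (x ⊓ y) ⊓ z
    ⊓-assoc x y z =
      ∨-cancel-by-complement x (¬¬-⊓ x (y ⊓ z)) (¬¬-⊓ (x ⊓ y) z) x-side ¬x-side
      where
      x-side : x ∨ (x ⊓ (y ⊓ z)) ≡ x ∨ ((x ⊓ y) ⊓ z)
      x-side = begin
        x ∨ (x ⊓ (y ⊓ z))              ≡⟨ ∨-abs-⊓ x (y ⊓ z) ⟩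
        ¬ (¬ x)                        ≡⟨ x⊓x≡¬¬x x ⟨
        x ⊓ x                          ≡⟨ ⊓-abs-∨ x z ⟨
        x ⊓ (x ∨ z)                    ≡⟨ ⊓-¬¬ˡ x _ ⟨
        (¬ (¬ x)) ⊓ (x ∨ z)            ≡⟨ cong (_⊓ (x ∨ z)) (∨-abs-⊓ x y) ⟨
        (x ∨ (x ⊓ y)) ⊓ (x ∨ z)        ≡⟨ ∨-distrib-⊓ x (x ⊓ y) z ⟨
        x ∨ ((x ⊓ y) ⊓ z)              ∎

      ¬x-side : (¬ x) ∨ (x ⊓ (y ⊓ z)) ≡ (¬ x) ∨ ((x ⊓ y) ⊓ z)
      ¬x-side = begin
        (¬ x) ∨ (x ⊓ (y ⊓ z))                  ≡⟨ ¬x∨[x⊓y]≡¬x∨y x (y ⊓ z) ⟩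
        (¬ x) ∨ (y ⊓ z)                        ≡⟨ ∨-distrib-⊓ (¬ x) y z ⟩
        ((¬ x) ∨ y) ⊓ ((¬ x) ∨ z)              ≡⟨ cong (_⊓ ((¬ x) ∨ z)) (¬x∨[x⊓y]≡¬x∨y x y) ⟨
        ((¬ x) ∨ (x ⊓ y)) ⊓ ((¬ x) ∨ z)        ≡⟨ ∨-distrib-⊓ (¬ x) (x ⊓ y) z ⟨
        (¬ x) ∨ ((x ⊓ y) ⊓ z)                  ∎

module _ {ℓ : Level} (A : Algebra2211 ℓ) where
  open Algebra2211 A

  IsDBA⇒IsDCore : IsDBA A → IsDCore A
  IsDBA⇒IsDCore dba = record
    { ax1a = ⊓-comm ; ax1b = ⊔-comm ; ax2a = ¬-⊓-idem ; ax2b = ⌟-⊔-idem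
    ; ax3a = ⊓-abs-⊔ ; ax3b = ⊔-abs-⊓ ; ax4a = ⊓-distrib-∨ ; ax4b = ⊔-distrib-∧
    ; ax5a = ¬¬-⊓ ; ax5b = ⌟⌟-⊔ ; ax6a = ⊓-¬ ; ax6b = ⊔-⌟ ; ax7 = mixed
    }
    where open IsDBA dba

  module _ (core : IsDCore A) where
    open IsDCore core

    meetHalf : Half.IsHalf _⊓_ ¬_ ⊤ ⊥
    meetHalf = record
      { ⊓-comm = ax1a ; ¬-⊓-idem = ax2a ; ⊓-distrib-∨ = ax4a ; ¬¬-⊓ = ax5a ; ⊓-¬ = ax6a
      ; ⊓-⊤ = λ x → trans (cong (x ⊓_) (sym (ax6b x))) (ax3a x (⌟ x))
      }

    joinHalf : Half.IsHalf _⊔_ ⌟_ ⊥ ⊤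
    joinHalf = record
      { ⊓-comm = ax1b ; ¬-⊓-idem = ax2b ; ⊓-distrib-∨ = ax4b ; ¬¬-⊓ = ax5b ; ⊓-¬ = ax6b
      ; ⊓-⊤ = λ x → trans (cong (x ⊔_) (sym (ax6a x))) (ax3b x (¬ x))
      }

  IsDCore⇒IsDBA : IsDCore A → IsDBA A
  IsDCore⇒IsDBA core = record
    { ⊓-idem-left = M.⊓-idem-left ; ⊔-idem-left = J.⊓-idem-left
    ; ⊓-comm = ax1a ; ⊔-comm = ax1b ; ¬-⊓-idem = ax2a ; ⌟-⊔-idem = ax2b
    ; ⊓-abs-⊔ = ax3a ; ⊔-abs-⊓ = ax3b ; ⊓-distrib-∨ = ax4a ; ⊔-distrib-∧ = ax4b
    ; ⊓-abs-∨ = M.⊓-abs-∨ ; ⊔-abs-∧ = J.⊓-abs-∨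
    ; ¬¬-⊓ = ax5a ; ⌟⌟-⊔ = ax5b ; ⊓-¬ = ax6a ; ⊔-⌟ = ax6b
    ; ¬⊤ = M.¬⊤≡⊥ ; ⌟⊥ = J.¬⊤≡⊥
    ; ⊓-assoc = M.⊓-assoc ; ⊔-assoc = J.⊓-assoc
    ; ¬⊥ = M.¬⊥≡⊤⊓⊤ ; ⌟⊤ = J.¬⊥≡⊤⊓⊤
    ; mixed = ax7
    }
    where
    open IsDCore core
    module M = Half.Properties _⊓_ ¬_ ⊤ ⊥ (meetHalf core)
    module J = Half.Properties _⊔_ ⌟_ ⊥ ⊤ (joinHalf core)

theorem3p13 : {ℓ : Level} (A : Algebra2211 ℓ) → IsDBA A ⇔ IsDCore A
theorem3p13 A = mk⇔ (IsDBA⇒IsDCore A) (IsDCore⇒IsDBA A)
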